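{- Let $n\geq 1$ and $a_1,\dots,a_n\geq 1$ be integers, and let $G=K_n(a_1,\dots,a_n)$ be the multistar graph. Then $\chi_{md}(G)=n$ if $a_i<n$ for some $1\leq i\leq n$, and $\chi_{md}(G)=n+1$ otherwise.
   Context: The multistar $K_n(a_1,\dots,a_n)$ is obtained from the complete graph $K_n$ with vertices $x_1,\dots,x_n$ by attaching $a_i\geq 1$ new pendant vertices to each $x_i$. For a vertex $v$, $N[v]=N(v)\cup\{v\}$; $v$ dominates exactly the vertices of $N[v]$. A majority dominator coloring of $G$ is a proper vertex coloring such that for every vertex $v$ there is a color class $C$ with $|N[v]\cap C|\geq |C|/2$. $\chi_{md}(G)$ is the minimum number of color classes in a majority dominator coloring of $G$. -}

module Defs where

open import Data.Nat using (ℕ; zero; suc; _+_; _*_; _≤_)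
open import Data.Fin using (Fin; zero; suc)
open import Data.Fin.Properties using () renaming (_≟_ to _≟ᶠ_)
open import Data.Bool using (Bool; true; false; _∧_)
open import Data.Empty using (⊥)
open import Data.Product using (Σ; Σ-syntax; ∃; ∃-syntax; _×_; _,_)
open import Data.Sum using (_⊎_; inj₁; inj₂)
import Data.Sum.Properties as SumP
import Data.Product.Properties as ProdP
open import Relation.Nullary using (¬_; Dec; yes; no)
open import Relation.Nullary.Decidable using (⌊_⌋; _⊎-dec_; ¬?)
open import Relation.Binary.PropositionalEquality using (_≡_)
open import Function.Definitions using (Surjective)

sumFin : {m : ℕ} → (Fin m → ℕ) → ℕ
sumFin {zero}  f = 0
sumFin {suc m} f = f zero + sumFin (λ i → f (suc i))

ind : Bool → ℕ
ind true  = 1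
ind false = 0

-- The multistar K_n(a_1,…,a_n).
-- Vertices: inj₁ i is the clique vertex x_i; inj₂ (i , j) is the j-th
-- pendant vertex attached to x_i (j ∈ Fin (a i)).

Vertex : (n : ℕ) → (Fin n → ℕ) → Set
Vertex n a = Fin n ⊎ Σ (Fin n) (λ i → Fin (a i))

Adj : (n : ℕ) (a : Fin n → ℕ) → Vertex n a → Vertex n a → Set
Adj n a (inj₁ i)       (inj₁ j)       = ¬ (i ≡ j)
Adj n a (inj₁ i)       (inj₂ (j , _)) = i ≡ j
Adj n a (inj₂ (i , _)) (inj₁ j)       = i ≡ j
Adj n a (inj₂ _)       (inj₂ _)       = ⊥

adj? : (n : ℕ) (a : Fin n → ℕ) (v w : Vertex n a) → Dec (Adj n a v w)
adj? n a (inj₁ i)       (inj₁ j)       = ¬? (i ≟ᶠ j)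
adj? n a (inj₁ i)       (inj₂ (j , _)) = i ≟ᶠ j
adj? n a (inj₂ (i , _)) (inj₁ j)       = i ≟ᶠ j
adj? n a (inj₂ _)       (inj₂ _)       = no (λ ())

_≟V_ : {n : ℕ} {a : Fin n → ℕ} (v w : Vertex n a) → Dec (v ≡ w)
_≟V_ = SumP.≡-dec _≟ᶠ_ (ProdP.≡-dec _≟ᶠ_ _≟ᶠ_)

inClosedNbhd? : (n : ℕ) (a : Fin n → ℕ) (v w : Vertex n a) → Dec (w ≡ v ⊎ Adj n a v w)
inClosedNbhd? n a v w = (w ≟V v) ⊎-dec adj? n a v w

count : (n : ℕ) (a : Fin n → ℕ) → (Vertex n a → Bool) → ℕ
count n a P = sumFin (λ i → ind (P (inj₁ i)))
            + sumFin (λ i → sumFin (λ (j : Fin (a i)) → ind (P (inj₂ (i , j)))))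

Coloring : (n : ℕ) (a : Fin n → ℕ) (k : ℕ) → Set
Coloring n a k = Vertex n a → Fin k

classSize : (n : ℕ) (a : Fin n → ℕ) {k : ℕ} → Coloring n a k → Fin k → ℕ
classSize n a c j = count n a (λ w → ⌊ c w ≟ᶠ j ⌋)

nbhdClassSize : (n : ℕ) (a : Fin n → ℕ) {k : ℕ} → Coloring n a k → Vertex n a → Fin k → ℕ
nbhdClassSize n a c v j =
  count n a (λ w → ⌊ inClosedNbhd? n a v w ⌋ ∧ ⌊ c w ≟ᶠ j ⌋)

Proper : (n : ℕ) (a : Fin n → ℕ) {k : ℕ} → Coloring n a k → Set
Proper n a c = ∀ v w → Adj n a v w → ¬ (c v ≡ c w)

-- A majority dominator coloring with exactly k (nonempty) color classes:
-- proper, every color used, and every vertex v has a color class C with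
-- |N[v] ∩ C| ≥ |C| / 2, i.e. |C| ≤ 2 |N[v] ∩ C|.
IsMDColoring : (n : ℕ) (a : Fin n → ℕ) {k : ℕ} → Coloring n a k → Set
IsMDColoring n a {k} c =
  Proper n a c
  × Surjective _≡_ _≡_ c
  × (∀ v → ∃[ j ] (classSize n a c j ≤ 2 * nbhdClassSize n a c v j))

ChiMD≡ : (n : ℕ) (a : Fin n → ℕ) → ℕ → Set
ChiMD≡ n a m =
  (Σ[ c ∈ Coloring n a m ] IsMDColoring n a c)
  × (∀ k (c : Coloring n a k) → IsMDColoring n a c → m ≤ k)

module Submission where

open import Defs
open import Data.Nat using (ℕ; _≤_; _<_; suc; zero; _+_; _*_; z≤n; s≤s)
open import Data.Nat.Properties
  using (≤-refl; ≤-trans; ≤-reflexive; +-comm; +-identityʳ; m≤m+n; m≤n+m; +-mono-≤; +-monoʳ-≤; *-monoʳ-≤;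
         n<1+n; 1+n≰n; ≮⇒≥; m≤n⇒m<n∨m≡n; module ≤-Reasoning)
open import Data.Fin using (Fin; zero; suc; punchIn; punchOut; inject≤; fromℕ<)
open import Data.Fin.Properties
  using (suc-injective; punchIn-injective; punchInᵢ≢i; punchOut-injective; inject≤-injective;
         pigeonhole; injective⇒≤; any?; <⇒≢)
  renaming (_≟_ to _≟ᶠ_)
open import Data.Bool using (Bool; true; false; _∧_)
open import Data.Sum using (_⊎_; inj₁; inj₂)
open import Data.Product using (Σ; Σ-syntax; ∃-syntax; _×_; _,_)
open import Relation.Nullary using (¬_; Dec; yes; no; contradiction)
open import Relation.Nullary.Decidable using (⌊_⌋)
open import Relation.Unary using (Decidable)
open import Relation.Binary.PropositionalEquality using (_≡_; _≢_; refl; sym; trans; cong; cong₂; subst)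
open import Function.Base using (_∘_)
open import Function.Definitions using (Injective)

-- The clique x₁ … xₙ forces n distinct colors, and with exactly n colors every color class
-- contains a clique vertex.  If some aᵢ₀ < n, color xᵢ with i, give the pendants of xᵢ₀
-- pairwise distinct colors other than i₀ and all other pendants the color i₀: every class
-- except that of i₀ then has at most two vertices, and every N[v] meets such a class.  If all
-- aᵢ ≥ n, one new color for all pendants leaves the singleton classes {xᵢ}.  With only n
-- colors, however, pigeonhole gives two pendants of x₁ of equal color, so that class has at
-- least three vertices and contains some xₘ; likewise some pendant v of xₘ lies in a class of
-- size at least three.  As N[v] = {v, xₘ} meets only these two classes, each in one vertex,
-- no class is dominated by v.

variable
  n k : ℕ
  a : Fin n → ℕ

ind≤1 : ∀ b → ind b ≤ 1
ind≤1 true  = s≤s z≤n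
ind≤1 false = z≤n

ind-∧-≤ʳ : ∀ x y → ind (x ∧ y) ≤ ind y
ind-∧-≤ʳ true  y = ≤-refl
ind-∧-≤ʳ false y = z≤n

⌊⌋≡true : {P : Set} (P? : Dec P) → P → ⌊ P? ⌋ ≡ true
⌊⌋≡true (yes _) _ = refl
⌊⌋≡true (no ¬p) p = contradiction p ¬p

⌊⌋≡false : {P : Set} (P? : Dec P) → ¬ P → ⌊ P? ⌋ ≡ false
⌊⌋≡false (yes p) ¬p = contradiction p ¬p
⌊⌋≡false (no _)  _  = refl

sumFin-≥-term : ∀ {m} (f : Fin m → ℕ) i → f i ≤ sumFin f
sumFin-≥-term f zero    = m≤m+n _ _
sumFin-≥-term f (suc i) = ≤-trans (sumFin-≥-term (λ j → f (suc j)) i) (m≤n+m _ _)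

sumFin-≥-pair : ∀ {m} (f : Fin m → ℕ) i j → i ≢ j → f i + f j ≤ sumFin f
sumFin-≥-pair f zero    zero    i≢j = contradiction refl i≢j
sumFin-≥-pair f zero    (suc j) _   = +-monoʳ-≤ (f zero) (sumFin-≥-term (λ k → f (suc k)) j)
sumFin-≥-pair f (suc i) zero    _   =
  subst (_≤ sumFin f) (+-comm (f zero) (f (suc i)))
        (+-monoʳ-≤ (f zero) (sumFin-≥-term (λ k → f (suc k)) i))
sumFin-≥-pair f (suc i) (suc j) i≢j =
  ≤-trans (sumFin-≥-pair (λ k → f (suc k)) i j (λ i≡j → i≢j (cong suc i≡j))) (m≤n+m _ _)

sumFin-≡0 : ∀ {m} (f : Fin m → ℕ) → (∀ i → f i ≡ 0) → sumFin f ≡ 0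
sumFin-≡0 {zero}  f _    = refl
sumFin-≡0 {suc m} f f≡0 rewrite f≡0 zero = sumFin-≡0 (λ i → f (suc i)) (λ i → f≡0 (suc i))

sumFin-≤-single : ∀ {m} (f : Fin m → ℕ) i → (∀ j → j ≢ i → f j ≡ 0) → sumFin f ≤ f i
sumFin-≤-single f zero others
  rewrite sumFin-≡0 (λ j → f (suc j)) (λ j → others (suc j) (λ ())) | +-identityʳ (f zero) = ≤-refl
sumFin-≤-single f (suc i) others rewrite others zero (λ ()) =
  sumFin-≤-single (λ j → f (suc j)) i (λ j j≢i → others (suc j) (j≢i ∘ suc-injective))

sumFin-ind-≤1 : ∀ {m} {P : Fin m → Set} (P? : Decidable P) →
                (∀ {i j} → P i → P j → i ≡ j) → sumFin (λ i → ind ⌊ P? i ⌋) ≤ 1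
sumFin-ind-≤1 P? unique with any? P?
... | yes (i , Pi) =
  ≤-trans (sumFin-≤-single _ i (λ j j≢i → cong ind (⌊⌋≡false (P? j) (λ Pj → j≢i (unique Pj Pi)))))
          (ind≤1 ⌊ P? i ⌋)
... | no none =
  ≤-trans (≤-reflexive (sumFin-≡0 _ (λ i → cong ind (⌊⌋≡false (P? i) (λ Pi → none (i , Pi)))))) z≤n

cliquePart : (Vertex n a → Bool) → ℕ
cliquePart P = sumFin (λ i → ind (P (inj₁ i)))

pendantPart : (Vertex n a → Bool) → ℕ
pendantPart {a = a} P = sumFin (λ i → sumFin (λ (t : Fin (a i)) → ind (P (inj₂ (i , t)))))

count-pos : (P : Vertex n a → Bool) (w : Vertex n a) → P w ≡ true → 1 ≤ count n a P
count-pos P (inj₁ i) Pw = begin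
  1                ≡⟨ cong ind (sym Pw) ⟩
  ind (P (inj₁ i)) ≤⟨ sumFin-≥-term _ i ⟩
  cliquePart P     ≤⟨ m≤m+n _ _ ⟩
  count _ _ P      ∎
  where open ≤-Reasoning
count-pos P (inj₂ (i , t)) Pw = begin
  1                                     ≡⟨ cong ind (sym Pw) ⟩
  ind (P (inj₂ (i , t)))                ≤⟨ sumFin-≥-term _ t ⟩
  sumFin (λ u → ind (P (inj₂ (i , u)))) ≤⟨ sumFin-≥-term _ i ⟩
  pendantPart P                         ≤⟨ m≤n+m _ _ ⟩
  count _ _ P                           ∎
  where open ≤-Reasoning

classSize-pos : (c : Coloring n a k) {l : Fin k} (w : Vertex n a) → c w ≡ l → 1 ≤ classSize n a c l
classSize-pos c {l} w cw≡l = count-pos (λ x → ⌊ c x ≟ᶠ l ⌋) w (⌊⌋≡true (c w ≟ᶠ l) cw≡l)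

nbhdClassSize-pos : (c : Coloring n a k) {v w : Vertex n a} → (w ≡ v ⊎ Adj n a v w) →
                    1 ≤ nbhdClassSize n a c v (c w)
nbhdClassSize-pos {n = n} {a = a} c {v} {w} w∈N[v] =
  count-pos (λ x → ⌊ inClosedNbhd? n a v x ⌋ ∧ ⌊ c x ≟ᶠ c w ⌋) w
            (cong₂ _∧_ (⌊⌋≡true (inClosedNbhd? n a v w) w∈N[v]) (⌊⌋≡true (c w ≟ᶠ c w) refl))

small-class-dominated : (c : Coloring n a k) {v w : Vertex n a} → (w ≡ v ⊎ Adj n a v w) →
                        classSize n a c (c w) ≤ 2 → classSize n a c (c w) ≤ 2 * nbhdClassSize n a c v (c w)
small-class-dominated c w∈N[v] small = ≤-trans small (*-monoʳ-≤ 2 (nbhdClassSize-pos c w∈N[v]))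

cliqueColor-injective : {c : Coloring n a k} → Proper n a c → Injective _≡_ _≡_ (λ i → c (inj₁ i))
cliqueColor-injective proper {i} {j} same with i ≟ᶠ j
... | yes i≡j = i≡j
... | no  i≢j = contradiction same (proper (inj₁ i) (inj₁ j) i≢j)

proper⇒n≤k : {c : Coloring n a k} → Proper n a c → n ≤ k
proper⇒n≤k proper = injective⇒≤ (cliqueColor-injective proper)

cliquePart-class-≤1 : {c : Coloring n a k} → Proper n a c → ∀ l →
                      cliquePart (λ w → ⌊ c w ≟ᶠ l ⌋) ≤ 1
cliquePart-class-≤1 {c = c} proper l =
  sumFin-ind-≤1 (λ i → c (inj₁ i) ≟ᶠ l)
                (λ cᵢ≡l cⱼ≡l → cliqueColor-injective proper (trans cᵢ≡l (sym cⱼ≡l)))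

module ColoringWithShortStar {n : ℕ} (a : Fin (suc n) → ℕ) (i₀ : Fin (suc n)) (short : a i₀ ≤ n)
                             (t₀ : Fin (a i₀)) where

  star₀Color : Fin (a i₀) → Fin (suc n)
  star₀Color t = punchIn i₀ (inject≤ t short)

  star₀Color-injective : ∀ {t u} → star₀Color t ≡ star₀Color u → t ≡ u
  star₀Color-injective {t} {u} same = inject≤-injective short short t u (punchIn-injective i₀ _ _ same)

  coloring : Coloring (suc n) a (suc n)
  coloring (inj₁ i) = i
  coloring (inj₂ (i , t)) with i ≟ᶠ i₀
  ... | yes refl = star₀Color t
  ... | no  _    = i₀

  coloring-star₀ : ∀ t → coloring (inj₂ (i₀ , t)) ≡ star₀Color t
  coloring-star₀ t with i₀ ≟ᶠ i₀
  ... | yes refl = refl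
  ... | no  i₀≢i₀ = contradiction refl i₀≢i₀

  coloring-otherStar : ∀ i t → i ≢ i₀ → coloring (inj₂ (i , t)) ≡ i₀
  coloring-otherStar i t i≢i₀ with i ≟ᶠ i₀
  ... | yes i≡i₀ = contradiction i≡i₀ i≢i₀
  ... | no  _    = refl

  pendant≢center : ∀ i t → coloring (inj₂ (i , t)) ≢ i
  pendant≢center i t with i ≟ᶠ i₀
  ... | yes refl = punchInᵢ≢i i₀ (inject≤ t short)
  ... | no  i≢i₀ = λ i₀≡i → i≢i₀ (sym i₀≡i)

  proper : Proper (suc n) a coloring
  proper (inj₁ i) (inj₁ j) i≢j same = i≢j same
  proper (inj₁ i) (inj₂ (.i , t)) refl same = pendant≢center i t (sym same)
  proper (inj₂ (i , t)) (inj₁ .i) refl same = pendant≢center i t same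

  small-class : ∀ l → l ≢ i₀ → classSize (suc n) a coloring l ≤ 2
  small-class l l≢i₀ = +-mono-≤ (cliquePart-class-≤1 proper l) pendants-≤1
    where
    pendants-≤1 : pendantPart (λ w → ⌊ coloring w ≟ᶠ l ⌋) ≤ 1
    pendants-≤1 = ≤-trans
      (sumFin-≤-single _ i₀ (λ i i≢i₀ → sumFin-≡0 _ (λ t →
        cong ind (⌊⌋≡false (coloring (inj₂ (i , t)) ≟ᶠ l)
                   (λ same → l≢i₀ (trans (sym same) (coloring-otherStar i t i≢i₀)))))))
      (sumFin-ind-≤1 (λ t → coloring (inj₂ (i₀ , t)) ≟ᶠ l) λ {t} {u} tₗ uₗ →
        star₀Color-injective (trans (sym (coloring-star₀ t)) (trans tₗ (trans (sym uₗ) (coloring-star₀ u)))))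

  nbhd-meets-small-class : ∀ v → Σ[ w ∈ Vertex (suc n) a ] (w ≡ v ⊎ Adj (suc n) a v w) × coloring w ≢ i₀
  nbhd-meets-small-class (inj₁ i) with i ≟ᶠ i₀
  ... | yes refl = inj₂ (i₀ , t₀) , inj₂ refl , pendant≢center i₀ t₀
  ... | no  i≢i₀ = inj₁ i , inj₁ refl , i≢i₀
  nbhd-meets-small-class (inj₂ (i , t)) with i ≟ᶠ i₀
  ... | yes refl = inj₂ (i₀ , t) , inj₁ refl , pendant≢center i₀ t
  ... | no  i≢i₀ = inj₁ i , inj₂ refl , i≢i₀

  dominated : ∀ v → ∃[ l ] (classSize (suc n) a coloring l ≤ 2 * nbhdClassSize (suc n) a coloring v l)
  dominated v with nbhd-meets-small-class v
  ... | w , w∈N[v] , w≢i₀ = coloring w , small-class-dominated coloring w∈N[v] (small-class _ w≢i₀)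

  isMD : IsMDColoring (suc n) a coloring
  isMD = proper , (λ l → inj₁ l , λ { refl → refl }) , dominated

module ColoringWithPendantColor {n : ℕ} (a : Fin n → ℕ) (p₀ : Σ (Fin n) (λ i → Fin (a i))) where

  coloring : Coloring n a (suc n)
  coloring (inj₁ i) = suc i
  coloring (inj₂ _) = zero

  proper : Proper n a coloring
  proper (inj₁ i) (inj₁ j) i≢j same = i≢j (suc-injective same)
  proper (inj₁ i) (inj₂ _) _ ()
  proper (inj₂ _) (inj₁ j) _ ()

  small-class : ∀ i → classSize n a coloring (suc i) ≤ 2
  small-class i = +-mono-≤ (cliquePart-class-≤1 proper (suc i)) (≤-trans (≤-reflexive no-pendants) z≤n)
    where
    no-pendants : pendantPart (λ w → ⌊ coloring w ≟ᶠ suc i ⌋) ≡ 0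
    no-pendants = sumFin-≡0 _ (λ j → sumFin-≡0 {a j} _ (λ t → refl))

  center-in-nbhd : ∀ v → Σ[ i ∈ Fin n ] (inj₁ i ≡ v ⊎ Adj n a v (inj₁ i))
  center-in-nbhd (inj₁ i)       = i , inj₁ refl
  center-in-nbhd (inj₂ (i , _)) = i , inj₂ refl

  dominated : ∀ v → ∃[ l ] (classSize n a coloring l ≤ 2 * nbhdClassSize n a coloring v l)
  dominated v with center-in-nbhd v
  ... | i , xᵢ∈N[v] = suc i , small-class-dominated coloring xᵢ∈N[v] (small-class i)

  isMD : IsMDColoring n a coloring
  isMD = proper , onto , dominated
    where
    onto : ∀ l → ∃[ v ] (∀ {w} → w ≡ v → coloring w ≡ l)
    onto zero    = inj₂ p₀ , λ { refl → refl }
    onto (suc i) = inj₁ i , λ { refl → refl }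

cliqueColors-cover : {c : Coloring n a n} → Proper n a c → ∀ l → ∃[ i ] c (inj₁ i) ≡ l
cliqueColors-cover {n = suc n} {c = c} proper l with any? (λ i → c (inj₁ i) ≟ᶠ l)
... | yes found = found
... | no  missed = contradiction (injective⇒≤ avoid-injective) 1+n≰n
  where
  l≢cliqueColor : ∀ i → l ≢ c (inj₁ i)
  l≢cliqueColor i l≡cᵢ = missed (i , sym l≡cᵢ)

  avoid : Fin (suc n) → Fin n
  avoid i = punchOut (l≢cliqueColor i)

  avoid-injective : Injective _≡_ _≡_ avoid
  avoid-injective {i} {j} same =
    cliqueColor-injective proper (punchOut-injective (l≢cliqueColor i) (l≢cliqueColor j) same)

pendants-share-color : {c : Coloring n a (suc k)} → Proper n a c → ∀ i → suc k ≤ a i →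
                       ∃[ t ] ∃[ t′ ] t ≢ t′ × c (inj₂ (i , t)) ≡ c (inj₂ (i , t′))
pendants-share-color {a = a} {k = k} {c = c} proper i many with pigeonhole (n<1+n k) avoidCenter
  where
  avoidCenter : Fin (suc k) → Fin k
  avoidCenter s = punchOut (proper (inj₁ i) (inj₂ (i , inject≤ s many)) refl)
... | s , s′ , s<s′ , same =
  inject≤ s many , inject≤ s′ many , (λ eq → <⇒≢ s<s′ (inject≤-injective many many s s′ eq)) ,
  punchOut-injective (proper (inj₁ i) (inj₂ (i , inject≤ s many)) refl)
                     (proper (inj₁ i) (inj₂ (i , inject≤ s′ many)) refl) same

class-≥3 : (c : Coloring n a k) {l : Fin k} {m i : Fin n} {t t′ : Fin (a i)} → t ≢ t′ →
           c (inj₁ m) ≡ l → c (inj₂ (i , t)) ≡ l → c (inj₂ (i , t′)) ≡ l → 3 ≤ classSize n a c l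
class-≥3 {n = n} {a = a} c {l} {m} {i} {t} {t′} t≢t′ cₘ≡l cₜ≡l cₜ′≡l = +-mono-≤ center pendants
  where
  open ≤-Reasoning
  inClass : Vertex n a → Bool
  inClass w = ⌊ c w ≟ᶠ l ⌋

  center : 1 ≤ cliquePart {a = a} inClass
  center = begin
    1                      ≡⟨ cong ind (sym (⌊⌋≡true (c (inj₁ m) ≟ᶠ l) cₘ≡l)) ⟩
    ind (inClass (inj₁ m)) ≤⟨ sumFin-≥-term (λ j → ind (inClass (inj₁ j))) m ⟩
    cliquePart inClass     ∎

  pendants : 2 ≤ pendantPart inClass
  pendants = begin
    2
      ≡⟨ cong₂ _+_ (cong ind (sym (⌊⌋≡true (c (inj₂ (i , t)) ≟ᶠ l) cₜ≡l)))
                   (cong ind (sym (⌊⌋≡true (c (inj₂ (i , t′)) ≟ᶠ l) cₜ′≡l))) ⟩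
    ind (inClass (inj₂ (i , t))) + ind (inClass (inj₂ (i , t′)))
      ≤⟨ sumFin-≥-pair (λ u → ind (inClass (inj₂ (i , u)))) t t′ t≢t′ ⟩
    sumFin (λ u → ind (inClass (inj₂ (i , u))))
      ≤⟨ sumFin-≥-term (λ j → sumFin (λ u → ind (inClass (inj₂ (j , u))))) i ⟩
    pendantPart inClass
      ∎

pendant-in-large-class : {c : Coloring n a n} → Proper n a c → ∀ i → n ≤ a i →
                         ∃[ t ] 3 ≤ classSize n a c (c (inj₂ (i , t)))
pendant-in-large-class {n = suc _} {c = c} proper i many with pendants-share-color proper i many
... | t , t′ , t≢t′ , same with cliqueColors-cover proper (c (inj₂ (i , t)))
... | m , cₘ≡cₜ = t , class-≥3 c t≢t′ cₘ≡cₜ refl (sym same)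

count-closedNbhd-pendant : ∀ m u (P : Vertex n a → Bool) →
  count n a (λ w → ⌊ inClosedNbhd? n a (inj₂ (m , u)) w ⌋ ∧ P w)
    ≤ ind (P (inj₁ m)) + ind (P (inj₂ (m , u)))
count-closedNbhd-pendant {n = n} {a = a} m u P = +-mono-≤ center pendant
  where
  InN : Vertex n a → Set
  InN w = w ≡ inj₂ (m , u) ⊎ Adj n a (inj₂ (m , u)) w

  Q : Vertex n a → Bool
  Q w = ⌊ inClosedNbhd? n a (inj₂ (m , u)) w ⌋ ∧ P w

  outside : ∀ w → ¬ InN w → ind (Q w) ≡ 0
  outside w w∉N = cong (λ b → ind (b ∧ P w)) (⌊⌋≡false (inClosedNbhd? n a (inj₂ (m , u)) w) w∉N)

  center : cliquePart Q ≤ ind (P (inj₁ m))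
  center = ≤-trans
    (sumFin-≤-single _ m (λ i i≢m → outside (inj₁ i) λ { (inj₁ ()) ; (inj₂ m≡i) → i≢m (sym m≡i) }))
    (ind-∧-≤ʳ _ (P (inj₁ m)))

  pendant : pendantPart Q ≤ ind (P (inj₂ (m , u)))
  pendant = ≤-trans
    (sumFin-≤-single _ m (λ i i≢m → sumFin-≡0 _ (λ t →
      outside (inj₂ (i , t)) λ { (inj₁ refl) → i≢m refl ; (inj₂ ()) })))
    (≤-trans
      (sumFin-≤-single _ u (λ t t≢u → outside (inj₂ (m , t)) λ { (inj₁ refl) → t≢u refl ; (inj₂ ()) }))
      (ind-∧-≤ʳ _ (P (inj₂ (m , u)))))

pendant-sees-small-class : {c : Coloring n a k} → IsMDColoring n a c → ∀ m u →
  classSize n a c (c (inj₁ m)) ≤ 2 ⊎ classSize n a c (c (inj₂ (m , u))) ≤ 2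
pendant-sees-small-class {c = c} (proper , onto , dominated) m u with dominated (inj₂ (m , u))
... | l , dom
  with c (inj₁ m) ≟ᶠ l | c (inj₂ (m , u)) ≟ᶠ l | count-closedNbhd-pendant m u (λ w → ⌊ c w ≟ᶠ l ⌋)
... | yes cₘ≡l | yes cᵤ≡l | _    =
  contradiction (trans cₘ≡l (sym cᵤ≡l)) (proper (inj₁ m) (inj₂ (m , u)) refl)
... | yes refl | no _     | nbhd = inj₁ (≤-trans dom (*-monoʳ-≤ 2 nbhd))
... | no _     | yes refl | nbhd = inj₂ (≤-trans dom (*-monoʳ-≤ 2 nbhd))
... | no _     | no _     | nbhd with onto l
...   | w , cw≡l =
  contradiction (≤-trans (classSize-pos c w (cw≡l refl)) (≤-trans dom (*-monoʳ-≤ 2 nbhd))) λ ()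

no-MDColoring-with-n-colors : (∀ i → suc n ≤ a i) → (c : Coloring (suc n) a (suc n)) →
                              ¬ IsMDColoring (suc n) a c
no-MDColoring-with-n-colors big c md@(proper , _ , _)
  with pendant-in-large-class proper zero (big zero)
... | t , large₀ with cliqueColors-cover proper (c (inj₂ (zero , t)))
... | m , cₘ≡cₜ with pendant-in-large-class proper m (big m) | pendant-sees-small-class md m
... | u , largeₘ | small with small u
... | inj₁ smallₘ = 1+n≰n (≤-trans (subst (λ l → 3 ≤ classSize _ _ c l) (sym cₘ≡cₜ) large₀) smallₘ)
... | inj₂ smallᵤ = 1+n≰n (≤-trans largeₘ smallᵤ)

proposition3p4 : (n : ℕ) (a : Fin n → ℕ) → 1 ≤ n → (∀ i → 1 ≤ a i) →
                   ((∃[ i ] (a i < n)) → ChiMD≡ n a n)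
                   × (¬ (∃[ i ] (a i < n)) → ChiMD≡ n a (suc n))
proposition3p4 zero    a ()
proposition3p4 (suc n) a _ hasPendant = someStarShort , allStarsLong
  where
  atLeastN : ∀ k (c : Coloring (suc n) a k) → IsMDColoring (suc n) a c → suc n ≤ k
  atLeastN k c (proper , _) = proper⇒n≤k proper

  someStarShort : ∃[ i ] (a i < suc n) → ChiMD≡ (suc n) a (suc n)
  someStarShort (i₀ , s≤s short) = (coloring , isMD) , atLeastN
    where open ColoringWithShortStar a i₀ short (fromℕ< (hasPendant i₀))

  allStarsLong : ¬ (∃[ i ] (a i < suc n)) → ChiMD≡ (suc n) a (suc (suc n))
  allStarsLong noShort = (coloring , isMD) , atLeastN+1
    where
    open ColoringWithPendantColor a (zero , fromℕ< (hasPendant zero))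

    atLeastN+1 : ∀ k (c : Coloring (suc n) a k) → IsMDColoring (suc n) a c → suc (suc n) ≤ k
    atLeastN+1 k c md with m≤n⇒m<n∨m≡n (atLeastN k c md)
    ... | inj₁ n<k  = n<k
    ... | inj₂ refl = contradiction md (no-MDColoring-with-n-colors allLong c)
      where
      allLong : ∀ i → suc n ≤ a i
      allLong i = ≮⇒≥ (λ short → noShort (i , short))
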